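{- Let $G$ be a finite simple graph that contains no induced subgraph isomorphic to $P_3\cup 2K_1$ and no induced subgraph isomorphic to $\overline{P_3\cup 2K_1}$, and suppose $\omega(G)\geq 4$. Let $A=\{v_1,\ldots,v_\omega\}$ be a maximum clique of $G$, where $\omega=\omega(G)$. For $k\in[\omega]$ let $I_k=\{v\in V(G)\setminus A: v \text{ is adjacent to } v_i \text{ for every } i\in[\omega]\setminus\{k\} \text{ and } v \text{ is not adjacent to } v_k\}$, let $U_k=\{v_k\}\cup I_k$, let $V_1=\bigcup_{k=1}^{\omega}U_k$ and $V_2=V(G)\setminus V_1$. Let $X$ be an independent subset of $V_2$ with $|X|\geq 2$. Then: (i) $N(X)\cap V_1\subseteq U_p\cup U_q$ for some $p,q\in[\omega]$; (ii) if $N(X)\cap U_p\neq\emptyset$ and $N(X)\cap U_q\neq\emptyset$ for distinct $p,q\in[\omega]$, then $|X|=2$; (iii) there exist $r,s\in[\omega]$ such that $\bigcup_{k=1}^{\omega}I_k\subseteq I_r\cup I_s$.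
   Context: $P_3\cup 2K_1$ denotes the disjoint union of a path on three vertices and two isolated vertices, and $\overline{H}$ is the complement of $H$. $\omega(G)$ is the clique number. For $T\subseteq V(G)$, $N(T)$ is the set of all vertices of $G$ adjacent to at least one vertex of $T$. $[k]=\{1,\ldots,k\}$. -}

module Defs where

open import Data.Nat using (ℕ; suc; _≥_)
open import Data.Fin using (Fin; zero; suc)
open import Data.Fin.Subset using (Subset; _∈_; ∣_∣)
open import Data.Bool using (Bool; true; false; not)
open import Data.Product using (Σ; ∃; _×_; _,_)
open import Data.Sum using (_⊎_)
open import Relation.Nullary using (¬_)
open import Relation.Binary.PropositionalEquality using (_≡_; _≢_)
open import Function.Definitions using (Injective)

record Graph (n : ℕ) : Set where
  field
    adj   : Fin n → Fin n → Bool
    adj-sym    : ∀ u v → adj u v ≡ adj v u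
    adj-irrefl : ∀ v → adj v v ≡ false
open Graph public

compl : ∀ {n} → Graph n → Graph n
compl G = record
  { adj = λ u v → ad u v
  ; adj-sym = sy
  ; adj-irrefl = ir }
  where
  open Data.Fin using (_≟_)
  open Relation.Nullary using (yes; no)
  ad : _ → _ → Bool
  ad u v with u ≟ v
  ... | yes _ = false
  ... | no _ = not (adj G u v)
  open Relation.Binary.PropositionalEquality using (refl; sym; cong)
  sy : ∀ u v → ad u v ≡ ad v u
  sy u v with u ≟ v | v ≟ u
  ... | yes _ | yes _ = refl
  ... | yes p | no q = Data.Empty.⊥-elim (q (sym p)) where import Data.Empty
  ... | no p | yes q = Data.Empty.⊥-elim (p (sym q)) where import Data.Empty
  ... | no _ | no _ = cong not (adj-sym G u v)
  ir : ∀ v → ad v v ≡ false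
  ir v with v ≟ v
  ... | yes _ = refl
  ... | no p = Data.Empty.⊥-elim (p refl) where import Data.Empty

InducedSub : ∀ {m n} → Graph m → Graph n → Set
InducedSub {m} {n} F G =
  Σ (Fin m → Fin n) λ f → Injective _≡_ _≡_ f ×
    (∀ i j → adj G (f i) (f j) ≡ adj F i j)

P3∪2K1-adj : Fin 5 → Fin 5 → Bool
P3∪2K1-adj zero (suc zero) = true
P3∪2K1-adj (suc zero) zero = true
P3∪2K1-adj (suc zero) (suc (suc zero)) = true
P3∪2K1-adj (suc (suc zero)) (suc zero) = true
P3∪2K1-adj _ _ = false

P3∪2K1 : Graph 5
P3∪2K1 = record { adj = P3∪2K1-adj ; adj-sym = s ; adj-irrefl = i }
  where
  open Relation.Binary.PropositionalEquality using (refl)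
  s : ∀ u v → P3∪2K1-adj u v ≡ P3∪2K1-adj v u
  s zero zero = refl
  s zero (suc zero) = refl
  s zero (suc (suc zero)) = refl
  s zero (suc (suc (suc zero))) = refl
  s zero (suc (suc (suc (suc zero)))) = refl
  s (suc zero) zero = refl
  s (suc zero) (suc zero) = refl
  s (suc zero) (suc (suc zero)) = refl
  s (suc zero) (suc (suc (suc zero))) = refl
  s (suc zero) (suc (suc (suc (suc zero)))) = refl
  s (suc (suc zero)) zero = refl
  s (suc (suc zero)) (suc zero) = refl
  s (suc (suc zero)) (suc (suc zero)) = refl
  s (suc (suc zero)) (suc (suc (suc zero))) = refl
  s (suc (suc zero)) (suc (suc (suc (suc zero)))) = refl
  s (suc (suc (suc zero))) zero = refl
  s (suc (suc (suc zero))) (suc zero) = refl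
  s (suc (suc (suc zero))) (suc (suc zero)) = refl
  s (suc (suc (suc zero))) (suc (suc (suc zero))) = refl
  s (suc (suc (suc zero))) (suc (suc (suc (suc zero)))) = refl
  s (suc (suc (suc (suc zero)))) zero = refl
  s (suc (suc (suc (suc zero)))) (suc zero) = refl
  s (suc (suc (suc (suc zero)))) (suc (suc zero)) = refl
  s (suc (suc (suc (suc zero)))) (suc (suc (suc zero))) = refl
  s (suc (suc (suc (suc zero)))) (suc (suc (suc (suc zero)))) = refl
  i : ∀ v → P3∪2K1-adj v v ≡ false
  i zero = refl
  i (suc zero) = refl
  i (suc (suc zero)) = refl
  i (suc (suc (suc zero))) = refl
  i (suc (suc (suc (suc zero)))) = refl

IsClique : ∀ {n k} → Graph n → (Fin k → Fin n) → Set
IsClique G v = Injective _≡_ _≡_ v × (∀ i j → i ≢ j → adj G (v i) (v j) ≡ true)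

IsMaxClique : ∀ {n} → Graph n → (ω : ℕ) → (Fin ω → Fin n) → Set
IsMaxClique {n} G ω v = IsClique G v × (∀ (w : Fin (suc ω) → Fin n) → ¬ IsClique G w)

module Partition {n ω : ℕ} (G : Graph n) (A : Fin ω → Fin n) where
  I : Fin ω → Fin n → Set
  I k v = (∀ i → v ≢ A i) × (∀ i → i ≢ k → adj G v (A i) ≡ true) × adj G v (A k) ≡ false
  U : Fin ω → Fin n → Set
  U k v = v ≡ A k ⊎ I k v
  V₁ : Fin n → Set
  V₁ v = ∃ λ k → U k v
  V₂ : Fin n → Set
  V₂ v = ¬ V₁ v
  N : Subset n → Fin n → Set
  N X v = ∃ λ x → x ∈ X × adj G v x ≡ true
  Independent : Subset n → Set
  Independent X = ∀ x y → x ∈ X → y ∈ X → adj G x y ≡ false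

-- Every vertex x ∈ V₂ misses at least two vertices of the maximum clique A.  Excluding the
-- complement of P₃ ∪ 2K₁ then forces x to have at most one neighbour in A and all its
-- neighbours in V₁ to lie in a single part U_k, and makes distinct parts U_p, U_q complete to
-- each other.  If x, y ∈ X see different parts U_p ∋ v and U_q ∋ w, a third z ∈ X would be
-- isolated from one of the paths x – v – A_r, y – w – A_r (r a fresh index), an induced
-- P₃ ∪ 2K₁; this gives (i) and (ii).  For (iii), if x, y ∈ X see only U_kx and U_ky and
-- u ∈ I_k with k ∉ {kx, ky}, then A_k – A_j – u together with x, y induces P₃ ∪ 2K₁.
module Submission where

open import Defs
open import Data.Nat using (ℕ; suc; _+_; _≤_; _<_; _≥_; s≤s; z≤n)
open import Data.Nat.Properties
  using (≤-trans; ≤-reflexive; ≤-antisym; ≤-<-trans; <⇒≱; ≮⇒≥; +-suc; +-monoʳ-≤; n≤1+n; m≤m+n; module ≤-Reasoning)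
open import Data.Fin using (Fin; zero; suc; _≟_)
open import Data.Fin.Patterns using (0F; 1F; 2F; 3F; 4F)
open import Data.Fin.Properties using (any?; all?; ¬∀⟶∃¬)
open import Data.Fin.Subset using (Subset; _∈_; _∉_; _⊆_; ∣_∣; ⁅_⁆; _∪_; ⊤; ⊥; inside; outside)
open import Data.Fin.Subset.Properties
  using (_∈?_; p⊆q⇒∣p∣≤∣q∣; ∣⊥∣≡0; ∣⊤∣≡n; ∣⁅x⁆∣≡1; x∈⁅x⁆; x∈p∪q⁺; x∉⁅y⁆⇒x≢y)
open import Data.Bool using (true; false)
import Data.Bool.Properties as Bool
open import Data.Vec using (_∷_; [])
import Data.Vec.Functional as Vector
open import Data.List using (List; _∷_; [])
open import Data.Product using (∃; ∃₂; _×_; _,_; proj₁; proj₂; map₂)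
open import Data.Product.Properties using (≡-dec)
open import Data.List.Membership.DecPropositional (≡-dec (_≟_ {5}) (_≟_ {5}))
  using () renaming (_∈_ to _∈ˡ_; _∈?_ to _∈ˡ?_)
open import Data.List.Relation.Unary.Any using (here; there)
open import Data.Sum using (_⊎_; inj₁; inj₂)
open import Data.Empty using () renaming (⊥ to Empty)
open import Function using (_∘_)
open import Function.Definitions using (Injective)
open import Relation.Nullary using (¬_; Dec; yes; no; ¬?; contradiction)
open import Relation.Nullary.Decidable using (from-yes; decidable-stable; _×-dec_; _⊎-dec_; _→-dec_)
open import Relation.Unary using (Pred)
open import Relation.Binary.Definitions using (Decidable)
open import Relation.Binary.PropositionalEquality
  using (_≡_; _≢_; refl; sym; trans; cong; subst; ≢-sym; module ≡-Reasoning)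

subst-⊎ : ∀ {a b} {A : Set a} (P : A → Set b) {x y z : A} → x ≡ y ⊎ x ≡ z → P x → P y ⊎ P z
subst-⊎ P (inj₁ refl) Px = inj₁ Px
subst-⊎ P (inj₂ refl) Px = inj₂ Px

∣p∪q∣≤∣p∣+∣q∣ : ∀ {n} (p q : Subset n) → ∣ p ∪ q ∣ ≤ ∣ p ∣ + ∣ q ∣
∣p∪q∣≤∣p∣+∣q∣ []            []            = z≤n
∣p∪q∣≤∣p∣+∣q∣ (inside  ∷ p) (inside  ∷ q) = s≤s (≤-trans (∣p∪q∣≤∣p∣+∣q∣ p q) (+-monoʳ-≤ ∣ p ∣ (n≤1+n ∣ q ∣)))
∣p∪q∣≤∣p∣+∣q∣ (inside  ∷ p) (outside ∷ q) = s≤s (∣p∪q∣≤∣p∣+∣q∣ p q)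
∣p∪q∣≤∣p∣+∣q∣ (outside ∷ p) (inside  ∷ q) = subst (suc ∣ p ∪ q ∣ ≤_) (sym (+-suc ∣ p ∣ ∣ q ∣)) (s≤s (∣p∪q∣≤∣p∣+∣q∣ p q))
∣p∪q∣≤∣p∣+∣q∣ (outside ∷ p) (outside ∷ q) = ∣p∪q∣≤∣p∣+∣q∣ p q

∣⁅x⁆∪p∣≤1+∣p∣ : ∀ {n} (x : Fin n) (p : Subset n) → ∣ ⁅ x ⁆ ∪ p ∣ ≤ suc ∣ p ∣
∣⁅x⁆∪p∣≤1+∣p∣ x p = subst (∣ ⁅ x ⁆ ∪ p ∣ ≤_) (cong (_+ ∣ p ∣) (∣⁅x⁆∣≡1 x)) (∣p∪q∣≤∣p∣+∣q∣ ⁅ x ⁆ p)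

∉⁅x⁆∪p : ∀ {n} {x y : Fin n} {p : Subset n} → y ∉ ⁅ x ⁆ ∪ p → y ≢ x × y ∉ p
∉⁅x⁆∪p {x = x} {p = p} y∉ =
  (λ { refl → y∉ (x∈p∪q⁺ {p = ⁅ x ⁆} {q = p} (inj₁ (x∈⁅x⁆ x))) }) ,
  (λ y∈p → y∉ (x∈p∪q⁺ {p = ⁅ x ⁆} (inj₂ y∈p)))

∣q∣<∣p∣⇒∃-∈-∉ : ∀ {n} (p q : Subset n) → ∣ q ∣ < ∣ p ∣ → ∃ λ x → x ∈ p × x ∉ q
∣q∣<∣p∣⇒∃-∈-∉ p q ∣q∣<∣p∣ with any? (λ x → x ∈? p ×-dec ¬? (x ∈? q))
... | yes found = found
... | no none   = contradiction (p⊆q⇒∣p∣≤∣q∣ p⊆q) (<⇒≱ ∣q∣<∣p∣)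
  where
  p⊆q : p ⊆ q
  p⊆q {x} x∈p = decidable-stable (x ∈? q) (λ x∉q → none (x , x∈p , x∉q))

two-elements : ∀ {n} {p : Subset n} → 2 ≤ ∣ p ∣ → ∃₂ λ x y → x ∈ p × y ∈ p × x ≢ y
two-elements {n} {p} 2≤∣p∣ =
  let x , x∈p , _     = ∣q∣<∣p∣⇒∃-∈-∉ p ⊥ (subst (_< ∣ p ∣) (sym (∣⊥∣≡0 n)) (≤-trans (s≤s z≤n) 2≤∣p∣))
      y , y∈p , y∉⁅x⁆ = ∣q∣<∣p∣⇒∃-∈-∉ p ⁅ x ⁆ (subst (_< ∣ p ∣) (sym (∣⁅x⁆∣≡1 x)) 2≤∣p∣)
  in x , y , x∈p , y∈p , ≢-sym (x∉⁅y⁆⇒x≢y y∉⁅x⁆)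

third-element : ∀ {n} {p : Subset n} → 2 < ∣ p ∣ → (x y : Fin n) → ∃ λ z → z ∈ p × z ≢ x × z ≢ y
third-element {p = p} 2<∣p∣ x y =
  let ∣⁅x,y⁆∣≤2     = ≤-trans (∣⁅x⁆∪p∣≤1+∣p∣ x ⁅ y ⁆) (s≤s (≤-reflexive (∣⁅x⁆∣≡1 y)))
      z , z∈p , z∉ = ∣q∣<∣p∣⇒∃-∈-∉ p (⁅ x ⁆ ∪ ⁅ y ⁆) (≤-<-trans ∣⁅x,y⁆∣≤2 2<∣p∣)
      z≢x , z∉⁅y⁆  = ∉⁅x⁆∪p z∉
  in z , z∈p , z≢x , x∉⁅y⁆⇒x≢y z∉⁅y⁆

fresh : ∀ {n} → 3 < n → (a b c : Fin n) → ∃ λ d → d ≢ a × d ≢ b × d ≢ c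
fresh {n} 3<n a b c =
  let d , _ , d∉ = ∣q∣<∣p∣⇒∃-∈-∉ (⊤ {n}) (⁅ a ⁆ ∪ ⁅ b ⁆ ∪ ⁅ c ⁆) ∣⁅a,b,c⁆∣<∣⊤∣
      d≢a , d∉′  = ∉⁅x⁆∪p d∉
      d≢b , d∉⁅c⁆ = ∉⁅x⁆∪p d∉′
  in d , d≢a , d≢b , x∉⁅y⁆⇒x≢y d∉⁅c⁆
  where
  open ≤-Reasoning
  ∣⁅a,b,c⁆∣<∣⊤∣ : ∣ ⁅ a ⁆ ∪ ⁅ b ⁆ ∪ ⁅ c ⁆ ∣ < ∣ ⊤ {n} ∣
  ∣⁅a,b,c⁆∣<∣⊤∣ = begin-strict
    ∣ ⁅ a ⁆ ∪ ⁅ b ⁆ ∪ ⁅ c ⁆ ∣ ≤⟨ ∣⁅x⁆∪p∣≤1+∣p∣ a _ ⟩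
    suc ∣ ⁅ b ⁆ ∪ ⁅ c ⁆ ∣     ≤⟨ s≤s (∣⁅x⁆∪p∣≤1+∣p∣ b _) ⟩
    2 + ∣ ⁅ c ⁆ ∣             ≡⟨ cong (2 +_) (∣⁅x⁆∣≡1 c) ⟩
    3                          <⟨ 3<n ⟩
    n                          ≡⟨ ∣⊤∣≡n n ⟨
    ∣ ⊤ {n} ∣                  ∎

fresh-pair : ∀ {n} → 3 < n → (a b : Fin n) → ∃₂ λ c d → c ≢ a × c ≢ b × d ≢ a × d ≢ b × d ≢ c
fresh-pair 3<n a b =
  let c , c≢a , c≢b , _   = fresh 3<n a b a
      d , d≢a , d≢b , d≢c = fresh 3<n a b c
  in c , d , c≢a , c≢b , d≢a , d≢b , d≢c

at-most-two : ∀ {k ℓ} {P : Pred (Fin (suc k)) ℓ} → (∀ t → Dec (P t))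
  → (∀ {p q t} → q ≢ p → t ≢ p → t ≢ q → P p → P q → P t → Empty)
  → ∃₂ λ p q → ∀ {t} → P t → t ≡ p ⊎ t ≡ q
at-most-two P? no-three with any? P?
... | no none = 0F , 0F , λ {t} Pt → contradiction (t , Pt) none
... | yes (p , Pp) with any? (λ q → ¬? (q ≟ p) ×-dec P? q)
...   | no none = p , p , λ {t} Pt → inj₁ (decidable-stable (t ≟ p) λ t≢p → none (t , t≢p , Pt))
...   | yes (q , q≢p , Pq) = p , q , λ {t} Pt →
  decidable-stable ((t ≟ p) ⊎-dec (t ≟ q)) λ t∉ → no-three q≢p (t∉ ∘ inj₁) (t∉ ∘ inj₂) Pp Pq Pt

module Adjacency {n} (G : Graph n) where

  infix 4 _~_ _≁_ _~?_

  _~_ _≁_ : Fin n → Fin n → Set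
  u ~ v = adj G u v ≡ true
  u ≁ v = adj G u v ≡ false

  _~?_ : Decidable _~_
  u ~? v = adj G u v Bool.≟ true

  ~-sym : ∀ {u v} → u ~ v → v ~ u
  ~-sym = trans (adj-sym G _ _)

  ≁-sym : ∀ {u v} → u ≁ v → v ≁ u
  ≁-sym = trans (adj-sym G _ _)

  ¬~⇒≁ : ∀ {u v} → ¬ u ~ v → u ≁ v
  ¬~⇒≁ = Bool.¬-not

  ≁⇒¬~ : ∀ {u v} → u ≁ v → ¬ u ~ v
  ≁⇒¬~ u≁v u~v = Bool.not-¬ u~v u≁v

Preserves : ∀ {m n} → Graph m → Graph n → (Fin m → Fin n) → Set
Preserves F G f = ∀ i j → adj G (f i) (f j) ≡ adj F i j

Separated : ∀ {m} → Graph m → Fin m → Fin m → Set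
Separated F i j = adj F i j ≡ true ⊎ ∃ λ k → adj F i k ≢ adj F j k

separated? : ∀ {m} (F : Graph m) → Decidable (Separated F)
separated? F i j = (adj F i j Bool.≟ true) ⊎-dec any? (λ k → ¬? (adj F i k Bool.≟ adj F j k))

preserves-separated : ∀ {m n} {F : Graph m} {G : Graph n} {f} → Preserves F G f
  → ∀ {i j} → Separated F i j → f i ≢ f j
preserves-separated {F = F} {G} {f} pres {i} {j} (inj₁ i~j) fi≡fj = contradiction true≡false λ ()
  where
  open ≡-Reasoning
  true≡false : true ≡ false
  true≡false = begin
    true                   ≡⟨ sym i~j ⟩
    adj F i j              ≡⟨ sym (pres i j) ⟩
    adj G (f i) (f j)      ≡⟨ cong (λ v → adj G v (f j)) fi≡fj ⟩
    adj G (f j) (f j)      ≡⟨ adj-irrefl G (f j) ⟩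
    false                  ∎
preserves-separated {F = F} {G} {f} pres {i} {j} (inj₂ (k , ik≢jk)) fi≡fj = ik≢jk (begin
    adj F i k              ≡⟨ sym (pres i k) ⟩
    adj G (f i) (f k)      ≡⟨ cong (λ v → adj G v (f k)) fi≡fj ⟩
    adj G (f j) (f k)      ≡⟨ pres j k ⟩
    adj F j k              ∎)
  where open ≡-Reasoning

induced : ∀ {m n} {F : Graph m} {G : Graph n} (f : Fin m → Fin n) → Preserves F G f
  → (∀ i j → i ≢ j → f i ≢ f j) → InducedSub F G
induced f pres distinct = f , (λ {i} {j} fi≡fj → decidable-stable (i ≟ j) λ i≢j → distinct i j i≢j fi≡fj) , pres

-- Pairs with equal neighbourhoods: adjacency alone cannot keep their images apart.
P₃∪2K₁-twins : List (Fin 5 × Fin 5)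
P₃∪2K₁-twins = (0F , 2F) ∷ (2F , 0F) ∷ (3F , 4F) ∷ (4F , 3F) ∷ []

P₃∪2K₁-separated : ∀ i j → i ≢ j → Separated P3∪2K1 i j ⊎ (i , j) ∈ˡ P₃∪2K₁-twins
P₃∪2K₁-separated = from-yes (all? λ i → all? λ j →
  ¬? (i ≟ j) →-dec (separated? P3∪2K1 i j ⊎-dec ((i , j) ∈ˡ? P₃∪2K₁-twins)))

co-P₃∪2K₁-separated : ∀ i j → i ≢ j → Separated (compl P3∪2K1) i j
co-P₃∪2K₁-separated = from-yes (all? λ i → all? λ j → ¬? (i ≟ j) →-dec separated? (compl P3∪2K1) i j)

module Gadgets {n} (G : Graph n) where

  open Adjacency G

  induced-P₃∪2K₁ : (a b c d e : Fin n)
    → a ~ b → b ~ c → a ≁ c → a ≁ d → a ≁ e → b ≁ d → b ≁ e → c ≁ d → c ≁ e → d ≁ e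
    → a ≢ c → d ≢ e → InducedSub P3∪2K1 G
  induced-P₃∪2K₁ a b c d e a~b b~c a≁c a≁d a≁e b≁d b≁e c≁d c≁e d≁e a≢c d≢e = induced {F = P3∪2K1} {G} f pres distinct
    where
    f : Fin 5 → Fin n
    f 0F = a
    f 1F = b
    f 2F = c
    f 3F = d
    f 4F = e
    pres : Preserves P3∪2K1 G f
    pres 0F 0F = adj-irrefl G a
    pres 0F 1F = a~b
    pres 0F 2F = a≁c
    pres 0F 3F = a≁d
    pres 0F 4F = a≁e
    pres 1F 0F = ~-sym a~b
    pres 1F 1F = adj-irrefl G b
    pres 1F 2F = b~c
    pres 1F 3F = b≁d
    pres 1F 4F = b≁e
    pres 2F 0F = ≁-sym a≁c
    pres 2F 1F = ~-sym b~c
    pres 2F 2F = adj-irrefl G c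
    pres 2F 3F = c≁d
    pres 2F 4F = c≁e
    pres 3F 0F = ≁-sym a≁d
    pres 3F 1F = ≁-sym b≁d
    pres 3F 2F = ≁-sym c≁d
    pres 3F 3F = adj-irrefl G d
    pres 3F 4F = d≁e
    pres 4F 0F = ≁-sym a≁e
    pres 4F 1F = ≁-sym b≁e
    pres 4F 2F = ≁-sym c≁e
    pres 4F 3F = ≁-sym d≁e
    pres 4F 4F = adj-irrefl G e
    distinct : ∀ i j → i ≢ j → f i ≢ f j
    distinct i j i≢j with P₃∪2K₁-separated i j i≢j
    ... | inj₁ sep                                      = preserves-separated {F = P3∪2K1} {G} pres sep
    ... | inj₂ (here refl)                              = a≢c
    ... | inj₂ (there (here refl))                      = ≢-sym a≢c
    ... | inj₂ (there (there (here refl)))              = d≢e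
    ... | inj₂ (there (there (there (here refl))))      = ≢-sym d≢e

  -- compl P3∪2K1 is the clique {a, c, d, e} plus a vertex b adjacent to exactly d and e.
  induced-co-P₃∪2K₁ : (a b c d e : Fin n)
    → a ≁ b → a ~ c → a ~ d → a ~ e → b ≁ c → b ~ d → b ~ e → c ~ d → c ~ e → d ~ e
    → InducedSub (compl P3∪2K1) G
  induced-co-P₃∪2K₁ a b c d e a≁b a~c a~d a~e b≁c b~d b~e c~d c~e d~e =
    induced {F = compl P3∪2K1} {G} f pres λ i j i≢j →
      preserves-separated {F = compl P3∪2K1} {G} pres (co-P₃∪2K₁-separated i j i≢j)
    where
    f : Fin 5 → Fin n
    f 0F = a
    f 1F = b
    f 2F = c
    f 3F = d
    f 4F = e
    pres : Preserves (compl P3∪2K1) G f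
    pres 0F 0F = adj-irrefl G a
    pres 0F 1F = a≁b
    pres 0F 2F = a~c
    pres 0F 3F = a~d
    pres 0F 4F = a~e
    pres 1F 0F = ≁-sym a≁b
    pres 1F 1F = adj-irrefl G b
    pres 1F 2F = b≁c
    pres 1F 3F = b~d
    pres 1F 4F = b~e
    pres 2F 0F = ~-sym a~c
    pres 2F 1F = ≁-sym b≁c
    pres 2F 2F = adj-irrefl G c
    pres 2F 3F = c~d
    pres 2F 4F = c~e
    pres 3F 0F = ~-sym a~d
    pres 3F 1F = ~-sym b~d
    pres 3F 2F = ~-sym c~d
    pres 3F 3F = adj-irrefl G d
    pres 3F 4F = d~e
    pres 4F 0F = ~-sym a~e
    pres 4F 1F = ~-sym b~e
    pres 4F 2F = ~-sym c~e
    pres 4F 3F = ~-sym d~e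
    pres 4F 4F = adj-irrefl G e

max-clique-non-neighbour : ∀ {n ω} {G : Graph n} {A : Fin ω → Fin n} → IsMaxClique G ω A
  → ∀ {x} → (∀ i → x ≢ A i) → ∃ λ k → adj G x (A k) ≡ false
max-clique-non-neighbour {G = G} {A} ((A-injective , A-clique) , maximal) {x} x∉A =
  map₂ Bool.¬-not
    (¬∀⟶∃¬ _ _ (λ k → adj G x (A k) Bool.≟ true) (λ x~A → maximal (x Vector.∷ A) (injective , clique x~A)))
  where
  injective : Injective _≡_ _≡_ (x Vector.∷ A)
  injective {zero}  {zero}  _      = refl
  injective {zero}  {suc j} x≡Aj   = contradiction x≡Aj (x∉A j)
  injective {suc i} {zero}  Ai≡x   = contradiction (sym Ai≡x) (x∉A i)
  injective {suc i} {suc j} Ai≡Aj  = cong suc (A-injective Ai≡Aj)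
  clique : (∀ k → adj G x (A k) ≡ true) → ∀ i j → i ≢ j → adj G ((x Vector.∷ A) i) ((x Vector.∷ A) j) ≡ true
  clique x~A zero    zero    i≢j = contradiction refl i≢j
  clique x~A zero    (suc j) _   = x~A j
  clique x~A (suc i) zero    _   = trans (adj-sym G _ _) (x~A i)
  clique x~A (suc i) (suc j) i≢j = A-clique i j (i≢j ∘ cong suc)

module CliqueStructure {n m : ℕ} (G : Graph n) (A : Fin (4 + m) → Fin n)
  (P₃∪2K₁-free : ¬ InducedSub P3∪2K1 G) (co-P₃∪2K₁-free : ¬ InducedSub (compl P3∪2K1) G)
  (A-max : IsMaxClique G (4 + m) A) where

  open Adjacency G
  open Gadgets G
  open Partition G A

  3<ω : 3 < 4 + m
  3<ω = m≤m+n 4 m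

  A~A : ∀ {i j} → i ≢ j → A i ~ A j
  A~A = proj₂ (proj₁ A-max) _ _

  I? : ∀ k v → Dec (I k v)
  I? k v = all? (λ i → ¬? (v ≟ A i)) ×-dec all? (λ i → ¬? (i ≟ k) →-dec v ~? A i) ×-dec (adj G v (A k) Bool.≟ false)

  U? : ∀ k v → Dec (U k v)
  U? k v = (v ≟ A k) ⊎-dec I? k v

  U⇒~A : ∀ {p u i} → U p u → i ≢ p → u ~ A i
  U⇒~A (inj₁ refl)          i≢p = A~A (≢-sym i≢p)
  U⇒~A (inj₂ (_ , u~A , _)) i≢p = u~A _ i≢p

  U⇒≁A : ∀ {p u} → U p u → u ≁ A p
  U⇒≁A (inj₁ refl)            = adj-irrefl G _
  U⇒≁A (inj₂ (_ , _ , u≁Ap)) = u≁Ap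

  V₂⇒∉A : ∀ {x} → V₂ x → ∀ i → x ≢ A i
  V₂⇒∉A x∈V₂ i x≡Ai = x∈V₂ (i , inj₁ x≡Ai)

  V₂-two-non-neighbours : ∀ {x} → V₂ x → ∃₂ λ k l → k ≢ l × x ≁ A k × x ≁ A l
  V₂-two-non-neighbours {x} x∈V₂ with max-clique-non-neighbour {G = G} A-max (V₂⇒∉A x∈V₂)
  ... | k , x≁Ak with ¬∀⟶∃¬ _ (λ l → l ≢ k → x ~ A l) (λ l → ¬? (l ≟ k) →-dec x ~? A l)
                        (λ x~rest → x∈V₂ (k , inj₂ (V₂⇒∉A x∈V₂ , x~rest , x≁Ak)))
  ...   | l , ¬[l≢k⇒x~Al] =
    k , l , (λ k≡l → ¬[l≢k⇒x~Al] λ l≢k → contradiction (sym k≡l) l≢k) , x≁Ak ,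
    ¬~⇒≁ (λ x~Al → ¬[l≢k⇒x~Al] λ _ → x~Al)

  V₂-A-neighbour-unique : ∀ {x i j} → V₂ x → x ~ A i → x ~ A j → i ≡ j
  V₂-A-neighbour-unique {x} {i} {j} x∈V₂ x~Ai x~Aj = decidable-stable (i ≟ j) λ i≢j →
    let k , l , k≢l , x≁Ak , x≁Al = V₂-two-non-neighbours x∈V₂
        index≢ : ∀ {a b} → x ≁ A a → x ~ A b → a ≢ b
        index≢ x≁Aa x~Ab = λ { refl → ≁⇒¬~ x≁Aa x~Ab }
    in co-P₃∪2K₁-free (induced-co-P₃∪2K₁ (A k) x (A l) (A i) (A j)
         (≁-sym x≁Ak) (A~A k≢l) (A~A (index≢ x≁Ak x~Ai)) (A~A (index≢ x≁Ak x~Aj))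
         x≁Al x~Ai x~Aj (A~A (index≢ x≁Al x~Ai)) (A~A (index≢ x≁Al x~Aj)) (A~A i≢j))

  U-complete : ∀ {p q u w} → U p u → U q w → p ≢ q → u ~ w
  U-complete {p} {q} {u} {w} u∈Uₚ w∈U_q p≢q = decidable-stable (u ~? w) λ ¬u~w →
    let r , s , r≢p , r≢q , s≢p , s≢q , s≢r = fresh-pair 3<ω p q
    in co-P₃∪2K₁-free (induced-co-P₃∪2K₁ (A q) w u (A r) (A s)
         (≁-sym (U⇒≁A w∈U_q)) (~-sym (U⇒~A u∈Uₚ (≢-sym p≢q))) (A~A (≢-sym r≢q)) (A~A (≢-sym s≢q))
         (≁-sym (¬~⇒≁ ¬u~w)) (U⇒~A w∈U_q r≢q) (U⇒~A w∈U_q s≢q) (U⇒~A u∈Uₚ r≢p) (U⇒~A u∈Uₚ s≢p)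
         (A~A (≢-sym s≢r)))

  V₂~U⇒≁A : ∀ {x p u i} → V₂ x → U p u → x ~ u → i ≢ p → x ≁ A i
  V₂~U⇒≁A {x} {p} {u} {i} x∈V₂ u∈Uₚ x~u i≢p = ¬~⇒≁ λ x~Ai →
    let j , l , j≢p , j≢i , l≢p , l≢i , l≢j = fresh-pair 3<ω p i
        x≁A : ∀ {k} → k ≢ i → x ≁ A k
        x≁A k≢i = ¬~⇒≁ λ x~Ak → k≢i (V₂-A-neighbour-unique x∈V₂ x~Ak x~Ai)
    in co-P₃∪2K₁-free (induced-co-P₃∪2K₁ (A j) x (A l) u (A i)
         (≁-sym (x≁A j≢i)) (A~A (≢-sym l≢j)) (~-sym (U⇒~A u∈Uₚ j≢p)) (A~A j≢i)
         (x≁A l≢i) x~u x~Ai (~-sym (U⇒~A u∈Uₚ l≢p)) (A~A l≢i) (U⇒~A u∈Uₚ i≢p))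

  V₂~U⇒≁U : ∀ {x p q u w} → V₂ x → U p u → U q w → p ≢ q → x ~ u → x ≁ w
  V₂~U⇒≁U {x} {p} {q} {u} {w} x∈V₂ u∈Uₚ w∈U_q p≢q x~u = ¬~⇒≁ λ x~w →
    let r , s , r≢p , r≢q , s≢p , s≢q , s≢r = fresh-pair 3<ω p q
    in co-P₃∪2K₁-free (induced-co-P₃∪2K₁ (A r) x (A s) u w
         (≁-sym (V₂~U⇒≁A x∈V₂ u∈Uₚ x~u r≢p)) (A~A (≢-sym s≢r)) (~-sym (U⇒~A u∈Uₚ r≢p)) (~-sym (U⇒~A w∈U_q r≢q))
         (V₂~U⇒≁A x∈V₂ u∈Uₚ x~u s≢p) x~u x~w (~-sym (U⇒~A u∈Uₚ s≢p)) (~-sym (U⇒~A w∈U_q s≢q))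
         (U-complete u∈Uₚ w∈U_q p≢q))

  V₂-U-neighbour-unique : ∀ {x p q u w} → V₂ x → U p u → U q w → x ~ u → x ~ w → p ≡ q
  V₂-U-neighbour-unique x∈V₂ u∈Uₚ w∈U_q x~u x~w =
    decidable-stable (_ ≟ _) λ p≢q → ≁⇒¬~ (V₂~U⇒≁U x∈V₂ u∈Uₚ w∈U_q p≢q x~u) x~w

  V₁-neighbours⊆U : Fin n → Fin (4 + m) → Set
  V₁-neighbours⊆U x k = ∀ {i u} → i ≢ k → U i u → x ≁ u

  V₂-V₁-neighbours⊆U : ∀ {x} → V₂ x → ∃ (V₁-neighbours⊆U x)
  V₂-V₁-neighbours⊆U {x} x∈V₂ with any? (λ k → any? (λ u → U? k u ×-dec x ~? u))
  ... | yes (k , w , w∈Uₖ , x~w) = k , λ i≢k u∈Uᵢ → V₂~U⇒≁U x∈V₂ w∈Uₖ u∈Uᵢ (≢-sym i≢k) x~w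
  ... | no none                  = 0F , λ {i} {u} _ u∈Uᵢ → ¬~⇒≁ λ x~u → none (i , u , u∈Uᵢ , x~u)

  I-index≡kx⊎ky : ∀ {x y kx ky k u} → x ≁ y → x ≢ y → V₁-neighbours⊆U x kx → V₁-neighbours⊆U y ky
    → I k u → k ≡ kx ⊎ k ≡ ky
  I-index≡kx⊎ky {x} {y} {kx} {ky} {k} {u} x≁y x≢y x-nbrs y-nbrs u∈Iₖ =
    decidable-stable ((k ≟ kx) ⊎-dec (k ≟ ky)) λ k∉ →
    let k≢kx = k∉ ∘ inj₁
        k≢ky = k∉ ∘ inj₂
        j , j≢k , j≢kx , j≢ky = fresh 3<ω k kx ky
    in P₃∪2K₁-free (induced-P₃∪2K₁ (A k) (A j) u x y
         (A~A (≢-sym j≢k)) (~-sym (U⇒~A (inj₂ u∈Iₖ) j≢k)) (≁-sym (U⇒≁A (inj₂ u∈Iₖ)))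
         (≁-sym (x-nbrs k≢kx (inj₁ refl))) (≁-sym (y-nbrs k≢ky (inj₁ refl)))
         (≁-sym (x-nbrs j≢kx (inj₁ refl))) (≁-sym (y-nbrs j≢ky (inj₁ refl)))
         (≁-sym (x-nbrs k≢kx (inj₂ u∈Iₖ))) (≁-sym (y-nbrs k≢ky (inj₂ u∈Iₖ)))
         x≁y (λ Aₖ≡u → proj₁ u∈Iₖ k (sym Aₖ≡u)) x≢y)

  module IndependentSubset (X : Subset n) (X⊆V₂ : ∀ x → x ∈ X → V₂ x) (X-independent : Independent X) where

    N? : ∀ v → Dec (N X v)
    N? v = any? λ x → x ∈? X ×-dec v ~? x

    -- According as z ≁ v or z ~ v, z is isolated from the path x – v – A_r or y – w – A_r.
    no-third-vertex : ∀ {x y z p q v w} → x ∈ X → y ∈ X → z ∈ X → U p v → x ~ v → U q w → y ~ w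
      → p ≢ q → z ≢ x → z ≢ y → Empty
    no-third-vertex {x} {y} {z} {p} {q} {v} {w} x∈X y∈X z∈X v∈Uₚ x~v w∈U_q y~w p≢q z≢x z≢y
      with V₂-V₁-neighbours⊆U (X⊆V₂ z z∈X)
    ... | k , z-nbrs with fresh 3<ω p q k
    ... | r , r≢p , r≢q , r≢k with z ~? v
    ... | no ¬z~v = P₃∪2K₁-free (induced-P₃∪2K₁ x v (A r) y z
          x~v (U⇒~A v∈Uₚ r≢p) (V₂~U⇒≁A x∈V₂ v∈Uₚ x~v r≢p) (X-independent x y x∈X y∈X) (X-independent x z x∈X z∈X)
          (≁-sym (V₂~U⇒≁U y∈V₂ w∈U_q v∈Uₚ (≢-sym p≢q) y~w)) (≁-sym (¬~⇒≁ ¬z~v))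
          (≁-sym (V₂~U⇒≁A y∈V₂ w∈U_q y~w r≢q)) (≁-sym (z-nbrs r≢k (inj₁ refl))) (X-independent y z y∈X z∈X)
          (V₂⇒∉A x∈V₂ r) (≢-sym z≢y))
      where
      x∈V₂ = X⊆V₂ x x∈X
      y∈V₂ = X⊆V₂ y y∈X
    ... | yes z~v = P₃∪2K₁-free (induced-P₃∪2K₁ y w (A r) x z
          y~w (U⇒~A w∈U_q r≢q) (V₂~U⇒≁A y∈V₂ w∈U_q y~w r≢q) (X-independent y x y∈X x∈X) (X-independent y z y∈X z∈X)
          (≁-sym (V₂~U⇒≁U x∈V₂ v∈Uₚ w∈U_q p≢q x~v)) (≁-sym (V₂~U⇒≁U (X⊆V₂ z z∈X) v∈Uₚ w∈U_q p≢q z~v))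
          (≁-sym (V₂~U⇒≁A x∈V₂ v∈Uₚ x~v r≢p)) (≁-sym (z-nbrs r≢k (inj₁ refl))) (X-independent x z x∈X z∈X)
          (V₂⇒∉A y∈V₂ r) (≢-sym z≢x))
      where
      x∈V₂ = X⊆V₂ x x∈X
      y∈V₂ = X⊆V₂ y y∈X

    N∩U≢∅ : Fin (4 + m) → Set
    N∩U≢∅ p = ∃ λ v → N X v × U p v

    N∩U≢∅-at-most-two : ∀ {p q t} → q ≢ p → t ≢ p → t ≢ q → N∩U≢∅ p → N∩U≢∅ q → N∩U≢∅ t → Empty
    N∩U≢∅-at-most-two q≢p t≢p t≢q
      (v₁ , (x₁ , x₁∈X , v₁~x₁) , v₁∈Uₚ) (v₂ , (x₂ , x₂∈X , v₂~x₂) , v₂∈U_q) (v₃ , (x₃ , x₃∈X , v₃~x₃) , v₃∈Uₜ) =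
      no-third-vertex x₁∈X x₂∈X x₃∈X v₁∈Uₚ (~-sym v₁~x₁) v₂∈U_q (~-sym v₂~x₂) (≢-sym q≢p)
        (λ { refl → t≢p (V₂-U-neighbour-unique (X⊆V₂ x₃ x₃∈X) v₃∈Uₜ v₁∈Uₚ (~-sym v₃~x₃) (~-sym v₁~x₁)) })
        (λ { refl → t≢q (V₂-U-neighbour-unique (X⊆V₂ x₃ x₃∈X) v₃∈Uₜ v₂∈U_q (~-sym v₃~x₃) (~-sym v₂~x₂)) })

    N∩V₁⊆U∪U : ∃₂ λ p q → ∀ v → N X v → V₁ v → U p v ⊎ U q v
    N∩V₁⊆U∪U =
      let p , q , two = at-most-two (λ t → any? λ v → N? v ×-dec U? t v) N∩U≢∅-at-most-two
      in p , q , λ v v∈N (t , v∈Uₜ) → subst-⊎ (λ t → U t v) (two (v , v∈N , v∈Uₜ)) v∈Uₜ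

    two-parts⇒∣X∣≡2 : 2 ≤ ∣ X ∣ → ∀ {p q} → p ≢ q → N∩U≢∅ p → N∩U≢∅ q → ∣ X ∣ ≡ 2
    two-parts⇒∣X∣≡2 2≤∣X∣ p≢q (v , (x , x∈X , v~x) , v∈Uₚ) (w , (y , y∈X , w~y) , w∈U_q) =
      ≤-antisym (≮⇒≥ λ 2<∣X∣ →
        let z , z∈X , z≢x , z≢y = third-element 2<∣X∣ x y
        in no-third-vertex x∈X y∈X z∈X v∈Uₚ (~-sym v~x) w∈U_q (~-sym w~y) p≢q z≢x z≢y)
      2≤∣X∣

    I⊆I∪I : 2 ≤ ∣ X ∣ → ∃₂ λ r s → ∀ k v → I k v → I r v ⊎ I s v
    I⊆I∪I 2≤∣X∣ =
      let x , y , x∈X , y∈X , x≢y = two-elements 2≤∣X∣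
          kx , x-nbrs = V₂-V₁-neighbours⊆U (X⊆V₂ x x∈X)
          ky , y-nbrs = V₂-V₁-neighbours⊆U (X⊆V₂ y y∈X)
      in kx , ky , λ k v v∈Iₖ →
           subst-⊎ (λ k → I k v) (I-index≡kx⊎ky (X-independent x y x∈X y∈X) x≢y x-nbrs y-nbrs v∈Iₖ) v∈Iₖ

lemma3p5 : ∀ {n : ℕ} (G : Graph n)
    → ¬ InducedSub P3∪2K1 G
    → ¬ InducedSub (compl P3∪2K1) G
    → (ω : ℕ) → ω ≥ 4
    → (A : Fin ω → Fin n) → IsMaxClique G ω A
    → (X : Subset n) → (∀ x → x ∈ X → Partition.V₂ G A x)
    → Partition.Independent G A X → ∣ X ∣ ≥ 2
    → (∃₂ λ p q → ∀ v → Partition.N G A X v → Partition.V₁ G A v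
          → Partition.U G A p v ⊎ Partition.U G A q v)
      × (∀ p q → p ≢ q
          → (∃ λ v → Partition.N G A X v × Partition.U G A p v)
          → (∃ λ v → Partition.N G A X v × Partition.U G A q v)
          → ∣ X ∣ ≡ 2)
      × (∃₂ λ r s → ∀ k v → Partition.I G A k v
          → Partition.I G A r v ⊎ Partition.I G A s v)
lemma3p5 G P₃∪2K₁-free co-P₃∪2K₁-free _ (s≤s (s≤s (s≤s (s≤s _)))) A A-max X X⊆V₂ X-independent 2≤∣X∣ =
  N∩V₁⊆U∪U , (λ _ _ → two-parts⇒∣X∣≡2 2≤∣X∣) , I⊆I∪I 2≤∣X∣
  where
  open CliqueStructure G A P₃∪2K₁-free co-P₃∪2K₁-free A-max
  open IndependentSubset X X⊆V₂ X-independent
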